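{- Let $\mathcal{C}$ be a category with finite products, weak equalisers and finite sums. Then $\mathcal{C}_{ex}$ is well-pointed if and only if the terminal object of $\mathcal{C}$ is non-degenerate and indecomposable and every object of $\mathcal{C}$ is a choice object.
   Context: Global elements $x\colon1\to X$ are written $x\in X$; for $a\colon A\to X$, $x\in_a$ means some $u\in A$ has $au=x$; $a$ is surjective if $x\in_a$ for all $x\in X$; an object is a choice object if every surjection onto it has a section. A terminal object is non-degenerate if it is not isomorphic to the initial object; indecomposable if for every coproduct diagram $i\colon X\to S\leftarrow Y\colon j$ and every $z\in S$, $z\in_i$ or $z\in_j$; a strong generator if every arrow $f\colon X\to Y$ such that each $y\in Y$ equals $fx$ for a unique $x\in X$ is an isomorphism. A category is well-pointed if its terminal object is projective, indecomposable, non-degenerate and a strong generator. Exact completion $\mathcal{C}_{ex}$: objects are pseudo-equivalence relations $r=\langle r_1,r_2\rangle\colon R\to X\times X$ of $\mathcal{C}$ (arrows for which there exist, not necessarily unique, $\rho$ with $r\rho=\langle1,1\rangle$, $\sigma$ with $r\sigma=\langle r_2,r_1\rangle$, and $\tau\colon Q\to R$ with $r\tau=\langle r_1p_1,r_2p_2\rangle$ for $(Q,p_1,p_2)$ a weak pullback — pullback without uniqueness — of $r_2,r_1$); arrows $r\to s$ (with $s\colon S\to Y\times Y$) are classes $[f]$ of $f\colon X\to Y$ admitting $\hat f\colon R\to S$ with $s\hat f=(f\times f)r$, where $f\sim g$ iff some $h\colon X\to S$ has $sh=\langle f,g\rangle$. -}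

module Defs where

open import Level using (Level; _⊔_) renaming (suc to lsuc)
open import Data.Product using (Σ; Σ-syntax; _×_; _,_)
open import Data.Sum using (_⊎_)
open import Relation.Nullary using (¬_)
open import Relation.Binary using (IsEquivalence)

record CatData (o ℓ e : Level) : Set (lsuc (o ⊔ ℓ ⊔ e)) where
  infix  4 _≈_
  infixr 9 _∘_
  field
    Obj : Set o
    _⇒_ : Obj → Obj → Set ℓ
    _≈_ : ∀ {A B} → A ⇒ B → A ⇒ B → Set e
    id  : ∀ {A} → A ⇒ A
    _∘_ : ∀ {A B C} → B ⇒ C → A ⇒ B → A ⇒ C

record IsCategory {o ℓ e} (D : CatData o ℓ e) : Set (o ⊔ ℓ ⊔ e) where
  open CatData D
  field
    ≈-equiv   : ∀ {A B} → IsEquivalence (_≈_ {A} {B})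
    assoc     : ∀ {A B C E} {f : A ⇒ B} {g : B ⇒ C} {h : C ⇒ E} →
                (h ∘ g) ∘ f ≈ h ∘ (g ∘ f)
    identityˡ : ∀ {A B} {f : A ⇒ B} → id ∘ f ≈ f
    identityʳ : ∀ {A B} {f : A ⇒ B} → f ∘ id ≈ f
    ∘-resp-≈  : ∀ {A B C} {f h : B ⇒ C} {g i : A ⇒ B} →
                f ≈ h → g ≈ i → f ∘ g ≈ h ∘ i

record Category (o ℓ e : Level) : Set (lsuc (o ⊔ ℓ ⊔ e)) where
  field
    cd    : CatData o ℓ e
    isCat : IsCategory cd
  open CatData cd public
  open IsCategory isCat public

module Notions {o ℓ e} (D : CatData o ℓ e) where
  open CatData D

  IsIso : ∀ {A B} → A ⇒ B → Set (ℓ ⊔ e)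
  IsIso {A} {B} f = Σ[ g ∈ B ⇒ A ] (g ∘ f ≈ id × f ∘ g ≈ id)

  Iso : Obj → Obj → Set (ℓ ⊔ e)
  Iso A B = Σ[ f ∈ A ⇒ B ] IsIso f

  IsTerminal : Obj → Set (o ⊔ ℓ ⊔ e)
  IsTerminal T = ∀ X → Σ[ ! ∈ X ⇒ T ] (∀ (f : X ⇒ T) → f ≈ !)

  IsInitial : Obj → Set (o ⊔ ℓ ⊔ e)
  IsInitial I = ∀ X → Σ[ ! ∈ I ⇒ X ] (∀ (f : I ⇒ X) → f ≈ !)

  IsCoproduct : ∀ {X Y S} → X ⇒ S → Y ⇒ S → Set (o ⊔ ℓ ⊔ e)
  IsCoproduct {X} {Y} {S} i j = ∀ {Z} (f : X ⇒ Z) (g : Y ⇒ Z) →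
    Σ[ h ∈ S ⇒ Z ] ((h ∘ i ≈ f × h ∘ j ≈ g) ×
      (∀ (h' : S ⇒ Z) → h' ∘ i ≈ f → h' ∘ j ≈ g → h' ≈ h))

  IsProduct : ∀ {P X Y} → P ⇒ X → P ⇒ Y → Set (o ⊔ ℓ ⊔ e)
  IsProduct {P} {X} {Y} p₁ p₂ = ∀ {Z} (f : Z ⇒ X) (g : Z ⇒ Y) →
    Σ[ h ∈ Z ⇒ P ] ((p₁ ∘ h ≈ f × p₂ ∘ h ≈ g) ×
      (∀ (h' : Z ⇒ P) → p₁ ∘ h' ≈ f → p₂ ∘ h' ≈ g → h' ≈ h))

  IsWeakEqualiser : ∀ {E X Y} → X ⇒ Y → X ⇒ Y → E ⇒ X → Set (o ⊔ ℓ ⊔ e)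
  IsWeakEqualiser {E} {X} {Y} f g m = (f ∘ m ≈ g ∘ m) ×
    (∀ {Z} (h : Z ⇒ X) → f ∘ h ≈ g ∘ h → Σ[ k ∈ Z ⇒ E ] (m ∘ k ≈ h))

  IsWeakPullback : ∀ {Q A B C} → A ⇒ C → B ⇒ C → Q ⇒ A → Q ⇒ B →
                   Set (o ⊔ ℓ ⊔ e)
  IsWeakPullback {Q} {A} {B} {C} f g p₁ p₂ = (f ∘ p₁ ≈ g ∘ p₂) ×
    (∀ {Z} (a : Z ⇒ A) (b : Z ⇒ B) → f ∘ a ≈ g ∘ b →
       Σ[ h ∈ Z ⇒ Q ] (p₁ ∘ h ≈ a × p₂ ∘ h ≈ b))

  IsCoequaliser : ∀ {A B C} → A ⇒ B → A ⇒ B → B ⇒ C → Set (o ⊔ ℓ ⊔ e)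
  IsCoequaliser {A} {B} {C} f g q = (q ∘ f ≈ q ∘ g) ×
    (∀ {Z} (h : B ⇒ Z) → h ∘ f ≈ h ∘ g →
       Σ[ k ∈ C ⇒ Z ] (k ∘ q ≈ h × (∀ (k' : C ⇒ Z) → k' ∘ q ≈ h → k' ≈ k)))

  IsRegularEpi : ∀ {B C} → B ⇒ C → Set (o ⊔ ℓ ⊔ e)
  IsRegularEpi {B} {C} q = Σ[ A ∈ Obj ] Σ[ f ∈ A ⇒ B ] Σ[ g ∈ A ⇒ B ]
    IsCoequaliser f g q

  Projective : Obj → Set (o ⊔ ℓ ⊔ e)
  Projective P = ∀ {A B} (q : A ⇒ B) → IsRegularEpi q →
    ∀ (b : P ⇒ B) → Σ[ u ∈ P ⇒ A ] (q ∘ u ≈ b)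

  module Points (one : Obj) where

    _∈[_] : ∀ {A X} → one ⇒ X → A ⇒ X → Set (ℓ ⊔ e)
    _∈[_] {A} x a = Σ[ u ∈ one ⇒ A ] (a ∘ u ≈ x)

    Surjective : ∀ {A X} → A ⇒ X → Set (ℓ ⊔ e)
    Surjective {A} {X} a = ∀ (x : one ⇒ X) → x ∈[ a ]

    ChoiceObject : Obj → Set (o ⊔ ℓ ⊔ e)
    ChoiceObject X = ∀ {A} (a : A ⇒ X) → Surjective a →
      Σ[ s ∈ X ⇒ A ] (a ∘ s ≈ id)

    NonDegenerate : Set (o ⊔ ℓ ⊔ e)
    NonDegenerate = ∀ (I : Obj) → IsInitial I → ¬ Iso one I

    Indecomposable : Set (o ⊔ ℓ ⊔ e)
    Indecomposable = ∀ {X Y S} (i : X ⇒ S) (j : Y ⇒ S) → IsCoproduct i j →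
      ∀ (z : one ⇒ S) → z ∈[ i ] ⊎ z ∈[ j ]

    StrongGenerator : Set (o ⊔ ℓ ⊔ e)
    StrongGenerator = ∀ {X Y} (f : X ⇒ Y) →
      (∀ (y : one ⇒ Y) → Σ[ x ∈ one ⇒ X ]
         (f ∘ x ≈ y × (∀ (x' : one ⇒ X) → f ∘ x' ≈ y → x' ≈ x))) →
      IsIso f

  WellPointed : Set (o ⊔ ℓ ⊔ e)
  WellPointed = Σ[ T ∈ Obj ] (IsTerminal T × Projective T
                 × Points.Indecomposable T × Points.NonDegenerate T
                 × Points.StrongGenerator T)

module _ {o ℓ e} (C : Category o ℓ e) where
  open Category C
  open Notions cd

  record HasFiniteProducts : Set (o ⊔ ℓ ⊔ e) where
    field
      ⊤          : Obj
      ⊤-terminal : IsTerminal ⊤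
      product    : ∀ X Y → Σ[ P ∈ Obj ] Σ[ p₁ ∈ P ⇒ X ] Σ[ p₂ ∈ P ⇒ Y ]
                     IsProduct p₁ p₂

  HasWeakEqualisers : Set (o ⊔ ℓ ⊔ e)
  HasWeakEqualisers = ∀ {X Y} (f g : X ⇒ Y) →
    Σ[ E ∈ Obj ] Σ[ m ∈ E ⇒ X ] IsWeakEqualiser f g m

  record HasFiniteSums : Set (o ⊔ ℓ ⊔ e) where
    field
      ⊥         : Obj
      ⊥-initial : IsInitial ⊥
      coproduct : ∀ X Y → Σ[ S ∈ Obj ] Σ[ i ∈ X ⇒ S ] Σ[ j ∈ Y ⇒ S ]
                    IsCoproduct i j

-- A pseudo-equivalence relation
-- r = ⟨r₁,r₂⟩ : R → X × X is recorded by its two components (an arrow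
-- into X × X is the same as a pair of arrows, and equations between such
-- arrows are componentwise).

module ExactCompletion {o ℓ e} (C : Category o ℓ e) where
  open Category C
  open Notions cd

  record PER : Set (o ⊔ ℓ ⊔ e) where
    field
      X R : Obj
      r₁ r₂ : R ⇒ X
      refl-w  : Σ[ ρ ∈ X ⇒ R ] (r₁ ∘ ρ ≈ id × r₂ ∘ ρ ≈ id)
      sym-w   : Σ[ σ ∈ R ⇒ R ] (r₁ ∘ σ ≈ r₂ × r₂ ∘ σ ≈ r₁)
      trans-w : ∀ {Q} (p₁ p₂ : Q ⇒ R) → IsWeakPullback r₂ r₁ p₁ p₂ →
                Σ[ τ ∈ Q ⇒ R ] (r₁ ∘ τ ≈ r₁ ∘ p₁ × r₂ ∘ τ ≈ r₂ ∘ p₂)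
  open PER

  record ExHom (r s : PER) : Set (ℓ ⊔ e) where
    field
      f    : X r ⇒ X s
      f̂    : R r ⇒ R s
      sq₁  : r₁ s ∘ f̂ ≈ f ∘ r₁ r
      sq₂  : r₂ s ∘ f̂ ≈ f ∘ r₂ r
  open ExHom

  _∼_ : ∀ {r s} → ExHom r s → ExHom r s → Set (ℓ ⊔ e)
  _∼_ {r} {s} φ ψ = Σ[ h ∈ X r ⇒ R s ] (r₁ s ∘ h ≈ f φ × r₂ s ∘ h ≈ f ψ)

  private
    module E {A B : Obj} = IsEquivalence (≈-equiv {A} {B})

  exId : ∀ {r} → ExHom r r
  exId {r} = record { f = id ; f̂ = id
    ; sq₁ = E.trans identityʳ (E.sym identityˡ)
    ; sq₂ = E.trans identityʳ (E.sym identityˡ) }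

  exComp : ∀ {r s t} → ExHom s t → ExHom r s → ExHom r t
  exComp {r} {s} {t} ψ φ = record
    { f = f ψ ∘ f φ ; f̂ = f̂ ψ ∘ f̂ φ
    ; sq₁ = E.trans (E.sym assoc) (E.trans (∘-resp-≈ (sq₁ ψ) E.refl)
            (E.trans assoc (E.trans (∘-resp-≈ E.refl (sq₁ φ)) (E.sym assoc))))
    ; sq₂ = E.trans (E.sym assoc) (E.trans (∘-resp-≈ (sq₂ ψ) E.refl)
            (E.trans assoc (E.trans (∘-resp-≈ E.refl (sq₂ φ)) (E.sym assoc))))
    }

  Cex : CatData (o ⊔ ℓ ⊔ e) (ℓ ⊔ e) (ℓ ⊔ e)
  Cex = record
    { Obj = PER ; _⇒_ = ExHom ; _≈_ = _∼_ ; id = exId ; _∘_ = exComp }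

module Submission where

-- C embeds in Cex as the discrete pseudo-equivalence relations
-- Δ Y, and Δ ⊤ is terminal in Cex.  Two tools do the
-- real work: the inverse image m⁻¹S of a relation S along an arrow m of C
-- (a Cex-object with a map to S), and the "choice" lemma that on a choice
-- object pointwise liftings assemble to a global lifting.
--   (⇐) Δ ⊤ is terminal; every Δ Y is projective; Δ ⊤ is indecomposable and
--       non-degenerate because ⊤ is; and choice turns a map that is bijective
--       on points into an isomorphism, so Δ ⊤ is a strong generator.
--   (⇒) A terminal T of Cex is isomorphic to Δ ⊤, whose points are the global
--       elements of C; indecomposability and non-degeneracy descend to ⊤, and
--       applying the strong generator property to the inverse image of Δ Y
--       along a surjection a : A → Y yields a section of a.

open import Level using (_⊔_)
open import Defs
open import Data.Product using (_×_; Σ-syntax; _,_; proj₁; proj₂)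
import Data.Sum as Sum
open import Function.Bundles using (_⇔_; mk⇔)
open import Relation.Binary using (IsEquivalence; Setoid)
import Relation.Binary.Reasoning.Setoid as SetoidReasoning

module CategoryFacts {o ℓ e} (C : Category o ℓ e) where
  open Category C
  open Notions cd

  module ≈ {A B : Obj} = IsEquivalence (≈-equiv {A} {B})

  hom-setoid : Obj → Obj → Setoid ℓ e
  hom-setoid A B = record { Carrier = A ⇒ B ; _≈_ = _≈_ ; isEquivalence = ≈-equiv }

  module HomReasoning {A B : Obj} = SetoidReasoning (hom-setoid A B)

  infixr 4 refl⟩∘⟨_
  infixl 5 _⟩∘⟨refl

  refl⟩∘⟨_ : ∀ {A B D} {f : B ⇒ D} {g g' : A ⇒ B} → g ≈ g' → f ∘ g ≈ f ∘ g'
  refl⟩∘⟨ p = ∘-resp-≈ ≈.refl p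

  _⟩∘⟨refl : ∀ {A B D} {f f' : B ⇒ D} {g : A ⇒ B} → f ≈ f' → f ∘ g ≈ f' ∘ g
  p ⟩∘⟨refl = ∘-resp-≈ p ≈.refl

  pullˡ : ∀ {A B D E} {h : D ⇒ E} {g : B ⇒ D} {f : A ⇒ B} {k : B ⇒ E} →
          h ∘ g ≈ k → h ∘ (g ∘ f) ≈ k ∘ f
  pullˡ p = ≈.trans (≈.sym assoc) (p ⟩∘⟨refl)

  pullʳ : ∀ {A B D E} {h : D ⇒ E} {g : B ⇒ D} {f : A ⇒ B} {k : A ⇒ D} →
          g ∘ f ≈ k → (h ∘ g) ∘ f ≈ h ∘ k
  pullʳ p = ≈.trans assoc (refl⟩∘⟨ p)

  terminal-arrows-equal : ∀ {T} → IsTerminal T → ∀ {A} (f g : A ⇒ T) → f ≈ g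
  terminal-arrows-equal {T} term {A} f g =
    ≈.trans (proj₂ (term A) f) (≈.sym (proj₂ (term A) g))

  initial-arrows-equal : ∀ {I} → IsInitial I → ∀ {A} (f g : I ⇒ A) → f ≈ g
  initial-arrows-equal {I} init {A} f g =
    ≈.trans (proj₂ (init A) f) (≈.sym (proj₂ (init A) g))

  id-iso : ∀ {A} → Iso A A
  id-iso = id , id , identityˡ , identityˡ

  terminals-iso : ∀ {T T'} → IsTerminal T → IsTerminal T' → Iso T T'
  terminals-iso {T} {T'} term term' =
    proj₁ (term' T) , proj₁ (term T') ,
    terminal-arrows-equal term _ _ , terminal-arrows-equal term' _ _

  iso-initial : ∀ {A I} → Iso A I → IsInitial I → IsInitial A
  iso-initial {A} {I} (f , g , gf≈id , _) init Z = ι ∘ f , unique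
    where
    ι = proj₁ (init Z)
    unique : (h : A ⇒ Z) → h ≈ ι ∘ f
    unique h = begin
      h             ≈⟨ identityʳ ⟨
      h ∘ id        ≈⟨ refl⟩∘⟨ gf≈id ⟨
      h ∘ (g ∘ f)   ≈⟨ pullˡ (proj₂ (init Z) (h ∘ g)) ⟩
      ι ∘ f         ∎
      where open HomReasoning

  coproduct-jointly-epic : ∀ {A B S Z} {i : A ⇒ S} {j : B ⇒ S} → IsCoproduct i j →
    {a b : S ⇒ Z} → a ∘ i ≈ b ∘ i → a ∘ j ≈ b ∘ j → a ≈ b
  coproduct-jointly-epic {i = i} {j} cp {a} {b} ai≈bi aj≈bj =
    ≈.trans (unique a ai≈bi aj≈bj) (≈.sym (unique b ≈.refl ≈.refl))
    where unique = proj₂ (proj₂ (cp (b ∘ i) (b ∘ j)))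

  coequaliser-epic : ∀ {A B D Z} {f g : A ⇒ B} {q : B ⇒ D} → IsCoequaliser f g q →
    {a b : D ⇒ Z} → a ∘ q ≈ b ∘ q → a ≈ b
  coequaliser-epic {f = f} {g} {q} (qf≈qg , universal) {a} {b} aq≈bq =
    ≈.trans (unique a aq≈bq) (≈.sym (unique b ≈.refl))
    where
    bq-coequalises : (b ∘ q) ∘ f ≈ (b ∘ q) ∘ g
    bq-coequalises = ≈.trans (pullʳ qf≈qg) (≈.sym assoc)
    unique = proj₂ (proj₂ (universal (b ∘ q) bq-coequalises))

module InExactCompletion {o ℓ e} (C : Category o ℓ e) (fp : HasFiniteProducts C)
  (weq : HasWeakEqualisers C) where
  open Category C
  open Notions cd
  open HasFiniteProducts fp
  open Points ⊤
  open CategoryFacts C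
  open ExactCompletion C
  open PER
  open ExHom renaming (f to arr; f̂ to arrᴿ)
  module CN = Notions Cex

  ! : ∀ {A} → A ⇒ ⊤
  ! {A} = proj₁ (⊤-terminal A)

  !-unique : ∀ {A} (f g : A ⇒ ⊤) → f ≈ g
  !-unique = terminal-arrows-equal ⊤-terminal

  infix 25 _⊗_
  _⊗_ : Obj → Obj → Obj
  A ⊗ B = proj₁ (product A B)

  π₁ : ∀ {A B} → A ⊗ B ⇒ A
  π₁ {A} {B} = proj₁ (proj₂ (product A B))

  π₂ : ∀ {A B} → A ⊗ B ⇒ B
  π₂ {A} {B} = proj₁ (proj₂ (proj₂ (product A B)))

  ⊗-product : ∀ {A B} → IsProduct (π₁ {A} {B}) π₂
  ⊗-product {A} {B} = proj₂ (proj₂ (proj₂ (product A B)))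

  ⟨_,_⟩ : ∀ {Z A B} → Z ⇒ A → Z ⇒ B → Z ⇒ A ⊗ B
  ⟨ f , g ⟩ = proj₁ (⊗-product f g)

  β₁ : ∀ {Z A B} {f : Z ⇒ A} {g : Z ⇒ B} → π₁ ∘ ⟨ f , g ⟩ ≈ f
  β₁ {f = f} {g} = proj₁ (proj₁ (proj₂ (⊗-product f g)))

  β₂ : ∀ {Z A B} {f : Z ⇒ A} {g : Z ⇒ B} → π₂ ∘ ⟨ f , g ⟩ ≈ g
  β₂ {f = f} {g} = proj₂ (proj₁ (proj₂ (⊗-product f g)))

  ⟨⟩-unique : ∀ {Z A B} {f : Z ⇒ A} {g : Z ⇒ B} (h : Z ⇒ A ⊗ B) →
              π₁ ∘ h ≈ f → π₂ ∘ h ≈ g → h ≈ ⟨ f , g ⟩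
  ⟨⟩-unique {f = f} {g} = proj₂ (proj₂ (⊗-product f g))

  pair-≈ : ∀ {Y Z Z' A B} {f : Z ⇒ A} {g : Z ⇒ B} {f' : Z' ⇒ A} {g' : Z' ⇒ B}
             {h : Y ⇒ Z} {h' : Y ⇒ Z'} →
           f ∘ h ≈ f' ∘ h' → g ∘ h ≈ g' ∘ h' → ⟨ f , g ⟩ ∘ h ≈ ⟨ f' , g' ⟩ ∘ h'
  pair-≈ p q = ≈.trans (⟨⟩-unique _ (pullˡ β₁) (pullˡ β₂))
                       (≈.sym (⟨⟩-unique _ (≈.trans (pullˡ β₁) (≈.sym p))
                                           (≈.trans (pullˡ β₂) (≈.sym q))))

  unpair-≈ : ∀ {Y Z Z' A B} {f : Z ⇒ A} {g : Z ⇒ B} {f' : Z' ⇒ A} {g' : Z' ⇒ B}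
               {h : Y ⇒ Z} {h' : Y ⇒ Z'} →
             ⟨ f , g ⟩ ∘ h ≈ ⟨ f' , g' ⟩ ∘ h' → f ∘ h ≈ f' ∘ h' × g ∘ h ≈ g' ∘ h'
  unpair-≈ p = ≈.trans (≈.sym (pullˡ β₁)) (≈.trans (refl⟩∘⟨ p) (pullˡ β₁))
             , ≈.trans (≈.sym (pullˡ β₂)) (≈.trans (refl⟩∘⟨ p) (pullˡ β₂))

  -- Weak pullbacks, built from a weak equaliser of the two legs on A ⊗ B.

  record WeakPullback {A B D : Obj} (f : A ⇒ D) (g : B ⇒ D) : Set (o ⊔ ℓ ⊔ e) where
    field
      Q  : Obj
      p₁ : Q ⇒ A
      p₂ : Q ⇒ B
      isWeakPullback : IsWeakPullback f g p₁ p₂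

    commutes : f ∘ p₁ ≈ g ∘ p₂
    commutes = proj₁ isWeakPullback

    factor : ∀ {Z} (a : Z ⇒ A) (b : Z ⇒ B) → f ∘ a ≈ g ∘ b →
             Σ[ h ∈ Z ⇒ Q ] (p₁ ∘ h ≈ a × p₂ ∘ h ≈ b)
    factor = proj₂ isWeakPullback

  weakPullback : ∀ {A B D} (f : A ⇒ D) (g : B ⇒ D) → WeakPullback f g
  weakPullback f g = record
    { Q = E ; p₁ = π₁ ∘ m ; p₂ = π₂ ∘ m
    ; isWeakPullback = ≈.trans (≈.sym assoc) (≈.trans m-equalises assoc) , factor }
    where
    E = proj₁ (weq (f ∘ π₁) (g ∘ π₂))
    m = proj₁ (proj₂ (weq (f ∘ π₁) (g ∘ π₂)))
    m-equalises = proj₁ (proj₂ (proj₂ (weq (f ∘ π₁) (g ∘ π₂))))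
    factor : ∀ {Z} a b → f ∘ a ≈ g ∘ b → Σ[ h ∈ Z ⇒ E ] ((π₁ ∘ m) ∘ h ≈ a × (π₂ ∘ m) ∘ h ≈ b)
    factor a b fa≈gb = h , ≈.trans (pullʳ mh≈⟨a,b⟩) β₁ , ≈.trans (pullʳ mh≈⟨a,b⟩) β₂
      where
      ⟨a,b⟩-equalises : (f ∘ π₁) ∘ ⟨ a , b ⟩ ≈ (g ∘ π₂) ∘ ⟨ a , b ⟩
      ⟨a,b⟩-equalises = ≈.trans (pullʳ β₁) (≈.trans fa≈gb (≈.sym (pullʳ β₂)))
      w = proj₂ (proj₂ (proj₂ (weq (f ∘ π₁) (g ∘ π₂)))) ⟨ a , b ⟩ ⟨a,b⟩-equalises
      h = proj₁ w
      mh≈⟨a,b⟩ = proj₂ w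

  -- The relation presented by a pseudo-equivalence relation P:
  -- a ~[ P ] b when ⟨a , b⟩ factors through ⟨r₁ , r₂⟩.  Equality of Cex-arrows
  -- is by definition  φ ∼ ψ = arr φ ~[ s ] arr ψ.

  Related : (P : PER) {Z : Obj} → Z ⇒ X P → Z ⇒ X P → Set (ℓ ⊔ e)
  Related P {Z} a b = Σ[ h ∈ Z ⇒ R P ] (r₁ P ∘ h ≈ a × r₂ P ∘ h ≈ b)

  infix 4 Related
  syntax Related P a b = a ~[ P ] b

  ~-resp : ∀ (P : PER) {Z} {a a' b b' : Z ⇒ X P} → a ≈ a' → b ≈ b' →
           a ~[ P ] b → a' ~[ P ] b'
  ~-resp P a≈a' b≈b' (h , r₁h≈a , r₂h≈b) = h , ≈.trans r₁h≈a a≈a' , ≈.trans r₂h≈b b≈b'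

  ≈⇒~ : ∀ (P : PER) {Z} {a b : Z ⇒ X P} → a ≈ b → a ~[ P ] b
  ≈⇒~ P {a = a} a≈b = ρ ∘ a , ≈.trans (pullˡ r₁ρ≈id) identityˡ
                             , ≈.trans (pullˡ r₂ρ≈id) (≈.trans identityˡ a≈b)
    where
    ρ = proj₁ (refl-w P)
    r₁ρ≈id = proj₁ (proj₂ (refl-w P))
    r₂ρ≈id = proj₂ (proj₂ (refl-w P))

  ~-refl : ∀ (P : PER) {Z} (a : Z ⇒ X P) → a ~[ P ] a
  ~-refl P a = ≈⇒~ P ≈.refl

  ~-sym : ∀ (P : PER) {Z} {a b : Z ⇒ X P} → a ~[ P ] b → b ~[ P ] a
  ~-sym P (h , r₁h≈a , r₂h≈b) = σ ∘ h , ≈.trans (pullˡ r₁σ≈r₂) r₂h≈b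
                                      , ≈.trans (pullˡ r₂σ≈r₁) r₁h≈a
    where
    σ = proj₁ (sym-w P)
    r₁σ≈r₂ = proj₁ (proj₂ (sym-w P))
    r₂σ≈r₁ = proj₂ (proj₂ (sym-w P))

  -- transitivity: glue the two witnesses along a weak pullback of r₂ and r₁
  ~-trans : ∀ (P : PER) {Z} {a b c : Z ⇒ X P} → a ~[ P ] b → b ~[ P ] c → a ~[ P ] c
  ~-trans P (h₁ , r₁h₁≈a , r₂h₁≈b) (h₂ , r₁h₂≈b , r₂h₂≈c) =
    τ ∘ k , ≈.trans (pullˡ r₁τ) (≈.trans (pullʳ p₁k≈h₁) r₁h₁≈a)
          , ≈.trans (pullˡ r₂τ) (≈.trans (pullʳ p₂k≈h₂) r₂h₂≈c)
    where
    open WeakPullback (weakPullback (r₂ P) (r₁ P))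
    glued = trans-w P p₁ p₂ isWeakPullback
    τ = proj₁ glued
    r₁τ = proj₁ (proj₂ glued)
    r₂τ = proj₂ (proj₂ glued)
    pair = factor h₁ h₂ (≈.trans r₂h₁≈b (≈.sym r₁h₂≈b))
    k = proj₁ pair
    p₁k≈h₁ = proj₁ (proj₂ pair)
    p₂k≈h₂ = proj₂ (proj₂ pair)

  r₁~r₂ : ∀ (P : PER) → r₁ P ~[ P ] r₂ P
  r₁~r₂ P = id , identityʳ , identityʳ

  ~-precomp : ∀ (P : PER) {Y Z} {a b : Z ⇒ X P} → a ~[ P ] b → (k : Y ⇒ Z) →
              a ∘ k ~[ P ] b ∘ k
  ~-precomp P (h , r₁h≈a , r₂h≈b) k = h ∘ k , ≈.trans (≈.sym assoc) (r₁h≈a ⟩∘⟨refl)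
                                            , ≈.trans (≈.sym assoc) (r₂h≈b ⟩∘⟨refl)

  ~-map : ∀ {P P' : PER} (φ : ExHom P P') {Z} {a b : Z ⇒ X P} → a ~[ P ] b →
          arr φ ∘ a ~[ P' ] arr φ ∘ b
  ~-map φ (h , r₁h≈a , r₂h≈b) = arrᴿ φ ∘ h , ≈.trans (pullˡ (sq₁ φ)) (pullʳ r₁h≈a)
                                          , ≈.trans (pullˡ (sq₂ φ)) (pullʳ r₂h≈b)

  -- Cex is a category; its laws hold because they hold in C on carriers.
  Cex-isCategory : IsCategory Cex
  Cex-isCategory = record
    { ≈-equiv = λ {r} {s} → record
        { refl = λ {φ} → ~-refl s (arr φ) ; sym = ~-sym s ; trans = ~-trans s }
    ; assoc = λ {_} {_} {_} {t} → ≈⇒~ t assoc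
    ; identityˡ = λ {_} {s} → ≈⇒~ s identityˡ
    ; identityʳ = λ {_} {s} → ≈⇒~ s identityʳ
    ; ∘-resp-≈ = λ {_} {_} {t} {φ} {_} {_} {γ} φ∼φ' γ∼γ' →
        ~-trans t (~-map φ γ∼γ') (~-precomp t φ∼φ' (arr γ))
    }

  CexCat : Category (o ⊔ ℓ ⊔ e) (ℓ ⊔ e) (ℓ ⊔ e)
  CexCat = record { cd = Cex ; isCat = Cex-isCategory }

  module ExCat = Category CexCat
  module Ex = CategoryFacts CexCat

  mkExHom : ∀ {s r : PER} (g : X s ⇒ X r) → g ∘ r₁ s ~[ r ] g ∘ r₂ s → ExHom s r
  mkExHom g (ĝ , r₁ĝ , r₂ĝ) = record { f = g ; f̂ = ĝ ; sq₁ = r₁ĝ ; sq₂ = r₂ĝ }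

  Δ : Obj → PER
  Δ Y = record { X = Y ; R = Y ; r₁ = id ; r₂ = id
    ; refl-w = id , identityˡ , identityˡ
    ; sym-w = id , identityˡ , identityˡ
    ; trans-w = λ p₁ p₂ wp → p₁ , ≈.refl , proj₁ wp }

  ~Δ⇒≈ : ∀ {Y Z} {a b : Z ⇒ Y} → a ~[ Δ Y ] b → a ≈ b
  ~Δ⇒≈ (h , h≈a , h≈b) = ≈.trans (≈.sym h≈a) h≈b

  fromΔ : ∀ (P : PER) {Y} → Y ⇒ X P → ExHom (Δ Y) P
  fromΔ P u = mkExHom u (≈⇒~ P (≈.trans identityʳ (≈.sym identityʳ)))

  Δ₁ : ∀ {A B} → A ⇒ B → ExHom (Δ A) (Δ B)
  Δ₁ = fromΔ (Δ _)

  Δ-preserves-terminal : CN.IsTerminal (Δ ⊤)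
  Δ-preserves-terminal P =
    mkExHom ! (≈⇒~ (Δ ⊤) (!-unique _ _)) , λ φ → ≈⇒~ (Δ ⊤) (!-unique _ _)

  Δ-preserves-initial : ∀ {Y} → IsInitial Y → CN.IsInitial (Δ Y)
  Δ-preserves-initial init P =
    mkExHom (proj₁ (init (X P))) (≈⇒~ P (initial-arrows-equal init _ _)) ,
    λ φ → ≈⇒~ P (initial-arrows-equal init _ _)

  Δ-reflects-initial : ∀ {Y} → CN.IsInitial (Δ Y) → IsInitial Y
  Δ-reflects-initial init Z = arr (proj₁ (init (Δ Z))) ,
    λ g → ~Δ⇒≈ (proj₂ (init (Δ Z)) (Δ₁ g))

  Δ-preserves-coproducts : ∀ {A B S} {i : A ⇒ S} {j : B ⇒ S} → IsCoproduct i j →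
                           CN.IsCoproduct (Δ₁ i) (Δ₁ j)
  Δ-preserves-coproducts {i = i} {j} cp {Z} φ ψ =
    fromΔ Z c , (≈⇒~ Z ci≈φ , ≈⇒~ Z cj≈ψ) , unique
    where
    c = proj₁ (cp (arr φ) (arr ψ))
    ci≈φ = proj₁ (proj₁ (proj₂ (cp (arr φ) (arr ψ))))
    cj≈ψ = proj₂ (proj₁ (proj₂ (cp (arr φ) (arr ψ))))
    -- the witnesses on the two summands combine into one witness on S
    unique : ∀ (h : ExHom (Δ _) Z) → exComp h (Δ₁ i) ∼ φ → exComp h (Δ₁ j) ∼ ψ →
             h ∼ fromΔ Z c
    unique h (w₁ , r₁w₁ , r₂w₁) (w₂ , r₁w₂ , r₂w₂) = w ,
      coproduct-jointly-epic cp (≈.trans (pullʳ wi≈w₁) r₁w₁) (≈.trans (pullʳ wj≈w₂) r₁w₂) ,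
      coproduct-jointly-epic cp (≈.trans (pullʳ wi≈w₁) (≈.trans r₂w₁ (≈.sym ci≈φ)))
                                (≈.trans (pullʳ wj≈w₂) (≈.trans r₂w₂ (≈.sym cj≈ψ)))
      where
      w = proj₁ (cp w₁ w₂)
      wi≈w₁ = proj₁ (proj₁ (proj₂ (cp w₁ w₂)))
      wj≈w₂ = proj₂ (proj₁ (proj₂ (cp w₁ w₂)))

  -- The inverse image m⁻¹S of S along m : W → X S relates z₁, z₂ exactly when
  -- m z₁ and m z₂ are S-related; it is a weak limit of ⟨r₁,r₂⟩ and m × m.
  module InverseImage (S : PER) {W : Obj} (m : W ⇒ X S) where
    private
      open WeakPullback (weakPullback ⟨ r₁ S , r₂ S ⟩ ⟨ m ∘ π₁ , m ∘ π₂ ⟩)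
      a₁ a₂ : Q ⇒ W
      a₁ = π₁ ∘ p₂
      a₂ = π₂ ∘ p₂

      r₁p₁≈ma₁ : r₁ S ∘ p₁ ≈ m ∘ a₁
      r₁p₁≈ma₁ = ≈.trans (proj₁ (unpair-≈ commutes)) assoc

      r₂p₁≈ma₂ : r₂ S ∘ p₁ ≈ m ∘ a₂
      r₂p₁≈ma₂ = ≈.trans (proj₂ (unpair-≈ commutes)) assoc

    InPreimage : ∀ {Z} → Z ⇒ W → Z ⇒ W → Set (ℓ ⊔ e)
    InPreimage {Z} z₁ z₂ = Σ[ h ∈ Z ⇒ Q ] (a₁ ∘ h ≈ z₁ × a₂ ∘ h ≈ z₂)

    image-related : ∀ {Z} {z₁ z₂ : Z ⇒ W} → InPreimage z₁ z₂ → m ∘ z₁ ~[ S ] m ∘ z₂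
    image-related (h , a₁h≈z₁ , a₂h≈z₂) =
      p₁ ∘ h , ≈.trans (pullˡ r₁p₁≈ma₁) (pullʳ a₁h≈z₁)
             , ≈.trans (pullˡ r₂p₁≈ma₂) (pullʳ a₂h≈z₂)

    preimage-related : ∀ {Z} {z₁ z₂ : Z ⇒ W} → m ∘ z₁ ~[ S ] m ∘ z₂ → InPreimage z₁ z₂
    preimage-related {z₁ = z₁} {z₂} (v , r₁v≈mz₁ , r₂v≈mz₂) =
      k , ≈.trans (pullʳ p₂k) β₁ , ≈.trans (pullʳ p₂k) β₂
      where
      square = pair-≈ (≈.trans r₁v≈mz₁ (≈.sym (pullʳ β₁)))
                      (≈.trans r₂v≈mz₂ (≈.sym (pullʳ β₂)))
      k = proj₁ (factor v ⟨ z₁ , z₂ ⟩ square)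
      p₂k = proj₂ (proj₂ (factor v ⟨ z₁ , z₂ ⟩ square))

    inverseImage : PER
    inverseImage = record { X = W ; R = Q ; r₁ = a₁ ; r₂ = a₂
      ; refl-w = preimage-related (~-refl S (m ∘ id))
      ; sym-w = preimage-related (~-sym S (image-related (id , identityʳ , identityʳ)))
      ; trans-w = λ q₁ q₂ wp → preimage-related (~-trans S
          (image-related (q₁ , ≈.refl , ≈.refl))
          (~-resp S (refl⟩∘⟨ ≈.sym (proj₁ wp)) ≈.refl (image-related (q₂ , ≈.refl , ≈.refl)))) }

    proj : ExHom inverseImage S
    proj = record { f = m ; f̂ = p₁ ; sq₁ = r₁p₁≈ma₁ ; sq₂ = r₂p₁≈ma₂ }

    lift : ∀ {P : PER} (φ : ExHom P S) (κ : X P ⇒ W) → m ∘ κ ≈ arr φ → ExHom P inverseImage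
    lift {P} φ κ mκ≈φ = mkExHom κ (preimage-related (~-resp S
      (≈.trans (via-m (r₁ P)) assoc) (≈.trans (via-m (r₂ P)) assoc) (~-map φ (r₁~r₂ P))))
      where
      via-m : ∀ {Y} (g : Y ⇒ X P) → arr φ ∘ g ≈ (m ∘ κ) ∘ g
      via-m g = ≈.sym mκ≈φ ⟩∘⟨refl

    proj∘lift : ∀ {P : PER} (φ : ExHom P S) (κ : X P ⇒ W) (mκ≈φ : m ∘ κ ≈ arr φ) →
                exComp proj (lift φ κ mκ≈φ) ∼ φ
    proj∘lift φ κ mκ≈φ = ≈⇒~ S mκ≈φ

    proj∘k-on : ∀ {P : PER} (k : ExHom S inverseImage) (ι : ExHom P S) (κ : X P ⇒ W)
      (mκ≈ι : m ∘ κ ≈ arr ι) → exComp k ι ∼ lift ι κ mκ≈ι →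
      exComp (exComp proj k) ι ∼ exComp exId ι
    proj∘k-on k ι κ mκ≈ι kι∼lift = begin
      exComp (exComp proj k) ι      ≈⟨ ExCat.assoc {f = ι} {g = k} {h = proj} ⟩
      exComp proj (exComp k ι)      ≈⟨ Ex.refl⟩∘⟨_ {f = proj} {g = exComp k ι}
                                                    {g' = lift ι κ mκ≈ι} kι∼lift ⟩
      exComp proj (lift ι κ mκ≈ι)   ≈⟨ proj∘lift ι κ mκ≈ι ⟩
      ι                             ≈⟨ ExCat.identityˡ {f = ι} ⟨
      exComp exId ι                 ∎
      where open Ex.HomReasoning

  choose : ∀ {Y D Z} → ChoiceObject Y → (α : D ⇒ Z) (β : Y ⇒ Z) →
           (∀ (y : ⊤ ⇒ Y) → Σ[ v ∈ ⊤ ⇒ D ] (α ∘ v ≈ β ∘ y)) → Σ[ k ∈ Y ⇒ D ] (α ∘ k ≈ β)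
  choose choice α β pointwise = p₁ ∘ s , (begin
      α ∘ (p₁ ∘ s)   ≈⟨ pullˡ commutes ⟩
      (β ∘ p₂) ∘ s   ≈⟨ pullʳ p₂s≈id ⟩
      β ∘ id         ≈⟨ identityʳ ⟩
      β              ∎)
    where
    open HomReasoning
    open WeakPullback (weakPullback α β)
    p₂-surjective : Surjective p₂
    p₂-surjective y = let (v , αv≈βy) = pointwise y
                          (h , _ , p₂h≈y) = factor v y αv≈βy
                      in h , p₂h≈y
    s = proj₁ (choice p₂ p₂-surjective)
    p₂s≈id = proj₂ (choice p₂ p₂-surjective)

  ~-by-choice : ∀ (P : PER) {Y} → ChoiceObject Y → (a b : Y ⇒ X P) →
                (∀ (y : ⊤ ⇒ Y) → a ∘ y ~[ P ] b ∘ y) → a ~[ P ] b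
  ~-by-choice P choice a b pointwise =
    k , ≈.trans (proj₁ components) identityʳ , ≈.trans (proj₂ components) identityʳ
    where
    lifted = choose choice ⟨ r₁ P , r₂ P ⟩ ⟨ a , b ⟩ λ y →
      let (v , r₁v , r₂v) = pointwise y in v , pair-≈ r₁v r₂v
    k = proj₁ lifted
    components = unpair-≈ (≈.trans (proj₂ lifted) (≈.sym identityʳ))

  section-by-choice : ∀ (s : PER) {W} → ChoiceObject (X s) → (F : W ⇒ X s) →
    (∀ (y : ⊤ ⇒ X s) → Σ[ x ∈ ⊤ ⇒ W ] (F ∘ x ~[ s ] y)) →
    Σ[ g ∈ X s ⇒ W ] (F ∘ g ~[ s ] id)
  section-by-choice s choice F pointwise =
    p₂ ∘ k , p₁ ∘ k , ≈.trans (pullˡ commutes) assoc , ≈.trans (≈.sym assoc) r₂p₁k≈id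
    where
    open WeakPullback (weakPullback (r₁ s) F)
    lifted = choose choice (r₂ s ∘ p₁) id λ y →
      let (x , h , r₁h , r₂h) = pointwise y
          (v , p₁v , p₂v) = factor h x r₁h
      in v , ≈.trans (pullʳ p₁v) (≈.trans r₂h (≈.sym identityˡ))
    k = proj₁ lifted
    r₂p₁k≈id = proj₂ lifted

  -- (⇐) Properties of the terminal object Δ ⊤ of Cex.

  -- every discrete object is projective: a regular epi q : A → B of Cex splits
  -- up to B through the inverse image of B along its carrier map
  Δ-projective : ∀ Y → CN.Projective (Δ Y)
  Δ-projective Y {A} {B} q (_ , g₁ , g₂ , coequaliser@(qg₁∼qg₂ , universal)) b =
    fromΔ A (arr k ∘ arr b) , ~-resp B assoc identityˡ (~-precomp B q∘k~id (arr b))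
    where
    open InverseImage B (arr q)
    q̃ : ExHom A inverseImage
    q̃ = lift q id identityʳ
    q̃-coequalises : exComp q̃ g₁ ∼ exComp q̃ g₂
    q̃-coequalises = ~-resp inverseImage (≈.sym identityˡ) (≈.sym identityˡ)
                      (preimage-related qg₁∼qg₂)
    k = proj₁ (universal q̃ q̃-coequalises)
    kq∼q̃ = proj₁ (proj₂ (universal q̃ q̃-coequalises))
    q∘k~id : arr q ∘ arr k ~[ B ] id
    q∘k~id = Ex.coequaliser-epic {f = g₁} {g = g₂} {q = q} coequaliser
               {a = exComp proj k} {b = exId} (proj∘k-on k q id identityʳ kq∼q̃)

  -- pulling S back along the carrier map X r + X s → X S, the coproduct property
  -- of S splits the projection; so each point z of S comes from a point of
  -- X r + X s, which lies in one summand since ⊤ is indecomposable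
  Δ⊤-indecomposable : HasFiniteSums C → Indecomposable → CN.Points.Indecomposable (Δ ⊤)
  Δ⊤-indecomposable sums indecomposable {r} {s} {S} i j cp z =
    Sum.map (covered i κ₁ mκ₁≈i) (covered j κ₂ mκ₂≈j)
            (indecomposable κ₁ κ₂ κ-coproduct (arr k ∘ arr z))
    where
    κ-sum = HasFiniteSums.coproduct sums (X r) (X s)
    W = proj₁ κ-sum
    κ₁ = proj₁ (proj₂ κ-sum)
    κ₂ = proj₁ (proj₂ (proj₂ κ-sum))
    κ-coproduct = proj₂ (proj₂ (proj₂ κ-sum))
    m : W ⇒ X S
    m = proj₁ (κ-coproduct (arr i) (arr j))
    mκ₁≈i = proj₁ (proj₁ (proj₂ (κ-coproduct (arr i) (arr j))))
    mκ₂≈j = proj₂ (proj₁ (proj₂ (κ-coproduct (arr i) (arr j))))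
    open InverseImage S m
    mediator = cp (lift i κ₁ mκ₁≈i) (lift j κ₂ mκ₂≈j)
    k = proj₁ mediator
    m∘k~id : m ∘ arr k ~[ S ] id
    m∘k~id = Ex.coproduct-jointly-epic {i = i} {j = j} cp {a = exComp proj k} {b = exId}
      (proj∘k-on k i κ₁ mκ₁≈i (proj₁ (proj₁ (proj₂ mediator))))
      (proj∘k-on k j κ₂ mκ₂≈j (proj₂ (proj₁ (proj₂ mediator))))
    -- a summand containing k z contains z
    covered : ∀ {P} (ι : ExHom P S) (κ : X P ⇒ W) → m ∘ κ ≈ arr ι →
              (arr k ∘ arr z) ∈[ κ ] → CN.Points._∈[_] (Δ ⊤) z ι
    covered {P} ι κ mκ≈ι (u , κu≈kz) =
      fromΔ P u , ~-resp S mkz≈ιu identityˡ (~-precomp S m∘k~id (arr z))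
      where
      mkz≈ιu : (m ∘ arr k) ∘ arr z ≈ arr ι ∘ u
      mkz≈ιu = begin
        (m ∘ arr k) ∘ arr z   ≈⟨ pullʳ (≈.sym κu≈kz) ⟩
        m ∘ (κ ∘ u)           ≈⟨ pullˡ mκ≈ι ⟩
        arr ι ∘ u             ∎
        where open HomReasoning

  Δ⊤-nondegenerate : NonDegenerate → CN.Points.NonDegenerate (Δ ⊤)
  Δ⊤-nondegenerate nondegenerate I I-initial Δ⊤≅I =
    nondegenerate ⊤ (Δ-reflects-initial (Ex.iso-initial Δ⊤≅I I-initial)) id-iso

  Δ⊤-strong-generator : (∀ Y → ChoiceObject Y) → CN.Points.StrongGenerator (Δ ⊤)
  Δ⊤-strong-generator choice {r} {s} φ bijective =
    mkExHom g g-respects , g∘F~id , F∘g~id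
    where
    F = arr φ
    -- injectivity on points: φ reflects the relations between points ...
    reflects : ∀ {x₁ x₂ : ⊤ ⇒ X r} → F ∘ x₁ ~[ s ] F ∘ x₂ → x₁ ~[ r ] x₂
    reflects {x₁} {x₂} Fx₁~Fx₂ =
      ~-trans r (unique (fromΔ r x₁) Fx₁~Fx₂) (~-sym r (unique (fromΔ r x₂) (~-refl s _)))
      where unique = proj₂ (proj₂ (bijective (fromΔ s (F ∘ x₂))))
    -- ... hence, by choice, between all arrows
    reflects-all : ∀ {Y} (a b : Y ⇒ X r) → F ∘ a ~[ s ] F ∘ b → a ~[ r ] b
    reflects-all a b Fa~Fb = ~-by-choice r (choice _) a b λ y →
      reflects (~-resp s assoc assoc (~-precomp s Fa~Fb y))
    -- surjectivity on points and choice give a section of F up to s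
    section = section-by-choice s (choice (X s)) F λ y →
      let (x , φx∼y , _) = bijective (fromΔ s y) in arr x , φx∼y
    g = proj₁ section
    F∘g~id = proj₂ section
    F∘g-cancels : ∀ {Y} (a : Y ⇒ X s) → F ∘ (g ∘ a) ~[ s ] a
    F∘g-cancels a = ~-resp s assoc identityˡ (~-precomp s F∘g~id a)
    g-respects : g ∘ r₁ s ~[ r ] g ∘ r₂ s
    g-respects = reflects-all _ _ (~-trans s (F∘g-cancels (r₁ s))
                   (~-trans s (r₁~r₂ s) (~-sym s (F∘g-cancels (r₂ s)))))
    g∘F~id : g ∘ F ~[ r ] id
    g∘F~id = reflects-all _ _ (~-resp s ≈.refl (≈.sym identityʳ) (F∘g-cancels F))

  -- (⇒) Points relative to an arbitrary terminal object T of Cex are, up to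
  -- the relations, just global elements of the carriers in C.
  module PointsOfTerminal {T : PER} (T-terminal : CN.IsTerminal T) where
    toT : ExHom (Δ ⊤) T
    toT = proj₁ (T-terminal (Δ ⊤))

    fromT : ExHom T (Δ ⊤)
    fromT = proj₁ (Δ-preserves-terminal T)

    collapses : arr toT ∘ ! ~[ T ] id
    collapses = Ex.terminal-arrows-equal T-terminal (exComp toT fromT) exId

    element : ∀ {P : PER} → ExHom T P → ⊤ ⇒ X P
    element φ = arr φ ∘ arr toT

    point : ∀ (P : PER) → ⊤ ⇒ X P → ExHom T P
    point P x = exComp (fromΔ P x) fromT

    point-element : ∀ {P : PER} (φ : ExHom T P) → point P (element φ) ∼ φ
    point-element {P} φ = ~-resp P (≈.sym assoc) identityʳ (~-map φ collapses)

    element-point : ∀ {P : PER} (x : ⊤ ⇒ X P) → element (point P x) ≈ x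
    element-point x = ≈.trans (pullʳ (!-unique _ id)) identityʳ

    ∈-descends : ∀ {A Y} {a : A ⇒ Y} {z : ⊤ ⇒ Y} →
                 CN.Points._∈[_] T (point (Δ Y) z) (Δ₁ a) → z ∈[ a ]
    ∈-descends {a = a} {z} (u , au~z!) = element u , (begin
      a ∘ (arr u ∘ arr toT)   ≈⟨ assoc ⟨
      (a ∘ arr u) ∘ arr toT   ≈⟨ ~Δ⇒≈ au~z! ⟩∘⟨refl ⟩
      (z ∘ !) ∘ arr toT       ≈⟨ element-point {Δ _} z ⟩
      z                       ∎)
      where open HomReasoning

  module _ {T : PER} (T-terminal : CN.IsTerminal T) where
    open PointsOfTerminal T-terminal

    ⊤-indecomposable : CN.Points.Indecomposable T → Indecomposable
    ⊤-indecomposable indecomposable i j cp z = Sum.map ∈-descends ∈-descends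
      (indecomposable (Δ₁ i) (Δ₁ j) (Δ-preserves-coproducts cp) (point _ z))

    ⊤-nondegenerate : CN.Points.NonDegenerate T → NonDegenerate
    ⊤-nondegenerate nondegenerate I I-initial ⊤≅I = nondegenerate (Δ ⊤)
      (Δ-preserves-initial (iso-initial ⊤≅I I-initial))
      (Ex.terminals-iso T-terminal Δ-preserves-terminal)

    -- a surjection a : A → Y gives a Cex-arrow m⁻¹(Δ Y) → Δ Y that is bijective
    -- on points; its inverse is a section of a
    every-object-choice : CN.Points.StrongGenerator T → ∀ Y → ChoiceObject Y
    every-object-choice strong Y a a-surjective =
      arr (proj₁ inverse) , ~Δ⇒≈ (proj₂ (proj₂ inverse))
      where
      open InverseImage (Δ Y) a
      bijective : ∀ (y : ExHom T (Δ Y)) → Σ[ x ∈ ExHom T inverseImage ]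
        (exComp proj x ∼ y × (∀ x' → exComp proj x' ∼ y → x' ∼ x))
      bijective y = point inverseImage u , ≈⇒~ (Δ Y) a∘x≈y ,
        λ x' ax'∼y → preimage-related (≈⇒~ (Δ Y) (≈.trans (~Δ⇒≈ ax'∼y) (≈.sym a∘x≈y)))
        where
        u = proj₁ (a-surjective (element y))
        au≈y = proj₂ (a-surjective (element y))
        a∘x≈y : a ∘ (u ∘ !) ≈ arr y
        a∘x≈y = ≈.trans (pullˡ au≈y) (~Δ⇒≈ (point-element y))
      inverse = strong proj bijective

proposition5p7 : ∀ {o ℓ e} (C : Category o ℓ e) →
    (fp : HasFiniteProducts C) → HasWeakEqualisers C → HasFiniteSums C →
    Notions.WellPointed (ExactCompletion.Cex C)
    ⇔ (Notions.Points.NonDegenerate (Category.cd C) (HasFiniteProducts.⊤ fp)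
    × Notions.Points.Indecomposable (Category.cd C) (HasFiniteProducts.⊤ fp)
    × (∀ (X : Category.Obj C) →
    Notions.Points.ChoiceObject (Category.cd C) (HasFiniteProducts.⊤ fp) X))
proposition5p7 C fp weq sums = mk⇔
  (λ { (T , T-terminal , _ , indecomposable , nondegenerate , strong) →
         ⊤-nondegenerate T-terminal nondegenerate
       , ⊤-indecomposable T-terminal indecomposable
       , every-object-choice T-terminal strong })
  (λ { (nondegenerate , indecomposable , choice) →
         Δ ⊤ , Δ-preserves-terminal , Δ-projective ⊤
       , Δ⊤-indecomposable sums indecomposable
       , Δ⊤-nondegenerate nondegenerate
       , Δ⊤-strong-generator choice })
  where
  open HasFiniteProducts fp using (⊤)
  open InExactCompletion C fp weq
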